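{- Let $\epsilon>0$. Consider an instance $A=(U,V,w)$ of the online matching problem (defined in the context) with nonnegative weight function $w$. Suppose that when each online point $v\in V$ arrives, the algorithm only knows approximate weights $\tilde w(u,v)$ for all $u\in U$ satisfying $$w(u,v)-\epsilon\le \tilde w(u,v)\le w(u,v)+\epsilon.$$ Then there exists a greedy online matching algorithm whose matching value $\mathsf{alg}$ satisfies $$\mathsf{alg}\ge \tfrac12\,\mathsf{opt}-\tfrac32\, n\epsilon,$$ where $n=|V|$ is the number of online points and $\mathsf{opt}$ is the maximum matching value achievable on the instance.
   Context: Online matching problem: a finite set $U$ of offline points is known in advance; online points $v\in V$ arrive one at a time, and upon arrival each $v$ must be irrevocably matched to some $u\in U$ without knowledge of future online points. An offline point may be matched to several online points; the value of a matching is $\sum_{u\in U}\max\{w(u,v): v\in V \text{ matched to } u\}$ (a term is $0$ if $u$ has no partner), where $w\ge 0$ is the weight function. $\mathsf{opt}$ denotes the maximum value over all assignments of the online points to offline points. The greedy algorithm maintains for each $u$ the current value $w_u$ (initially $0$) and matches each arriving $v$ to a $u$ maximizing the increment $\max\{w(u,v)-w_u,0\}$ (here computed with the available weights).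
   Formalization: The weights w, the approximate weights and the parameter ε are rational rather than real. -}

module Defs where

open import Data.Nat using (ℕ; suc)
open import Data.Fin using (Fin; toℕ)
open import Data.Fin.Properties using () renaming (_≟_ to _≟ᶠ_)
open import Data.Nat.Properties using () renaming (_<?_ to _<?ℕ_)
open import Data.List using (List; foldr; filter; map)
open import Data.List.Base using (allFin)
open import Data.Integer using (+_)
open import Data.Rational using (ℚ; 0ℚ; _⊔_; _-_; _≤_; _+_)
open import Relation.Nullary using (does)
open import Data.Bool using (if_then_else_)

-- Offline points: U = Fin m.  Online points: V = Fin n, arriving in the
-- order 0, 1, ..., n-1.  Weights are rationals.
-- An assignment ("matching") sends each online point to an offline point.
Weights : ℕ → ℕ → Set
Weights m n = Fin m → Fin n → ℚ

Assignment : ℕ → ℕ → Set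
Assignment m n = Fin n → Fin m

curVal : ∀ {m n} → Weights m n → Assignment m n → Fin m → List (Fin n) → ℚ
curVal W σ u vs =
  foldr (λ v acc → if does (σ v ≟ᶠ u) then W u v ⊔ acc else acc) 0ℚ vs

before : ∀ {n} → Fin n → List (Fin n)
before {n} v = filter (λ v' → toℕ v' <?ℕ toℕ v) (allFin n)

value : ∀ {m n} → Weights m n → Assignment m n → ℚ
value {m} {n} W σ = foldr _+_ 0ℚ (map (λ u → curVal W σ u (allFin n)) (allFin m))

increment : ∀ {m n} → Weights m n → Assignment m n → Fin n → Fin m → ℚ
increment W σ v u = (W u v - curVal W σ u (before v)) ⊔ 0ℚ

-- σ is a run of the greedy algorithm using weights W (ties broken arbitrarily):
-- every arriving v is matched to an offline point maximizing the increment.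
IsGreedy : ∀ {m n} → Weights m n → Assignment m n → Set
IsGreedy W σ = ∀ v u → increment W σ v u ≤ increment W σ v (σ v)

{-# OPTIONS --safe #-}
module Submission where

-- Let est u be the final value of u in the greedy run measured with the estimates w̃, and let the
-- gain of an arrival v be the increment it realises.  As the greedy choice maximises the increment
-- and w ≤ w̃ + ε, every w u v is at most est u + gain v + ε.  Hence, replaying the optimal
-- assignment τ arrival by arrival on top of the values est u, the total grows by at most
-- gain v + ε per arrival; the gains add up to at most Σ est, so opt ≤ 2 Σ est + n ε.  In the other
-- direction est u is at most the value of u under w + ε, which per arrival grows by at most ε more
-- than the true value, so Σ est ≤ alg + n ε.

open import Defs
open import Data.Nat using (ℕ; zero; suc)
open import Data.Fin using (Fin; zero; suc; toℕ; fromℕ<)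
open import Data.Integer using (+_)
open import Data.Rational using (ℚ; 0ℚ; 1ℚ; ½; _/_; _+_; _-_; _*_; _≤_; _<_; _⊔_; -_; +-0-rawMonoid)

import Data.Nat as ℕ
import Data.Nat.Properties as ℕ
import Data.Integer as ℤ
import Data.Integer.Properties as ℤ
open import Data.Nat.Coprimality using (1-coprimeTo) renaming (sym to coprime-sym)
open import Data.Fin.Properties using (toℕ-injective; toℕ<n; toℕ-fromℕ<; punchInᵢ≢i)
  renaming (_≟_ to _≟ᶠ_)
open import Data.List using (List; []; _∷_; foldr; filter; map; allFin; tabulate)
open import Data.List.Properties using (map-tabulate)
open import Data.List.Membership.Propositional using (_∈_)
open import Data.List.Membership.Propositional.Properties using (∈-filter⁺; ∈-filter⁻; ∈-allFin)
open import Data.List.Relation.Unary.Any using (here; there)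
open import Data.Vec.Functional using (removeAt)
open import Data.Rational.Properties
  using (normalize-coprime; /-cong; ≤-refl; ≤-trans; ≤-reflexive; <⇒≤; +-assoc; +-identityʳ; +-inverseʳ;
         +-mono-≤; +-monoˡ-≤; +-monoʳ-≤; *-monoˡ-≤-nonNeg; ⊔-lub; p≤p⊔q; p≤q⊔p; p≤q⇒p≤r⊔q;
         +-0-commutativeMonoid; module ≤-Reasoning)
open import Data.Rational.Solver using (module +-*-Solver)
open import Algebra.Definitions.RawMonoid +-0-rawMonoid using (sum)
open import Algebra.Properties.CommutativeMonoid.Sum +-0-commutativeMonoid using (sum-remove)
open import Data.Bool using (true; false; if_then_else_)
open import Data.Sum using (_⊎_; inj₁; inj₂)
open import Data.Product using (proj₂)
open import Data.Empty using (⊥-elim)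
open import Function using (_∘_; id)
open import Relation.Nullary using (does; yes; no)
open import Relation.Binary.PropositionalEquality

open +-*-Solver using (solve; _:+_; _:*_; _:-_; _:=_; con)

[1+k]/1≡1+k/1 : ∀ k → + suc k / 1 ≡ 1ℚ + + k / 1
[1+k]/1≡1+k/1 k rewrite normalize-coprime (coprime-sym (1-coprimeTo k)) =
  /-cong {p₁ = + suc k} {q₁ = 1} (cong (ℤ._+_ (+ 1)) (sym (ℤ.*-identityʳ (+ k)))) refl

p-r≤q⇒p≤q+r : ∀ {p q r} → p - r ≤ q → p ≤ q + r
p-r≤q⇒p≤q+r {p} {q} {r} p-r≤q = begin
  p            ≡⟨ solve 2 (λ p r → p := (p :- r) :+ r) refl p r ⟩
  (p - r) + r  ≤⟨ +-monoˡ-≤ r p-r≤q ⟩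
  q + r        ∎
  where open ≤-Reasoning

p≤p+q : ∀ {p q} → 0ℚ ≤ q → p ≤ p + q
p≤p+q {p} 0≤q = ≤-trans (≤-reflexive (sym (+-identityʳ p))) (+-monoʳ-≤ p 0≤q)

p≤q+[p-q]⊔0 : ∀ p q → p ≤ q + ((p - q) ⊔ 0ℚ)
p≤q+[p-q]⊔0 p q = begin
  p                    ≡⟨ solve 2 (λ p q → p := q :+ (p :- q)) refl p q ⟩
  q + (p - q)          ≤⟨ +-monoʳ-≤ q (p≤p⊔q (p - q) 0ℚ) ⟩
  q + ((p - q) ⊔ 0ℚ)   ∎
  where open ≤-Reasoning

q+[p-q]⊔0-lub : ∀ {p q r} → p ≤ r → q ≤ r → q + ((p - q) ⊔ 0ℚ) ≤ r
q+[p-q]⊔0-lub {p} {q} {r} p≤r q≤r = begin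
  q + ((p - q) ⊔ 0ℚ)  ≤⟨ +-monoʳ-≤ q (⊔-lub (+-monoˡ-≤ (- q) p≤r) 0≤r-q) ⟩
  q + (r - q)         ≡⟨ solve 2 (λ q r → q :+ (r :- q) := r) refl q r ⟩
  r                   ∎
  where
  open ≤-Reasoning
  0≤r-q : 0ℚ ≤ r - q
  0≤r-q = begin
    0ℚ     ≡⟨ sym (+-inverseʳ q) ⟩
    q - q  ≤⟨ +-monoˡ-≤ (- q) q≤r ⟩
    r - q  ∎

sum-mono-≤ : ∀ {k} {f g : Fin k → ℚ} → (∀ u → f u ≤ g u) → sum f ≤ sum g
sum-mono-≤ {zero}  f≤g = ≤-refl
sum-mono-≤ {suc k} f≤g = +-mono-≤ (f≤g zero) (sum-mono-≤ (f≤g ∘ suc))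

sum-nonNeg : ∀ {k} {f : Fin k → ℚ} → (∀ u → 0ℚ ≤ f u) → 0ℚ ≤ sum f
sum-nonNeg {zero}  0≤f = ≤-refl
sum-nonNeg {suc k} 0≤f = +-mono-≤ (0≤f zero) (sum-nonNeg (0≤f ∘ suc))

sum-removeAt-mono-≤ : ∀ {k} {f g : Fin (suc k) → ℚ} (a : Fin (suc k)) →
                      (∀ u → u ≢ a → f u ≤ g u) → sum (removeAt f a) ≤ sum (removeAt g a)
sum-removeAt-mono-≤ a f≤g = sum-mono-≤ (λ u → f≤g _ (punchInᵢ≢i a u))

sum-gain-at : ∀ {k} {f g : Fin k → ℚ} (a : Fin k) {d : ℚ} →
              (∀ u → u ≢ a → f u ≤ g u) → f a + d ≤ g a → sum f + d ≤ sum g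
sum-gain-at {suc k} {f} {g} a {d} f≤g fa+d≤ga = begin
  sum f + d                       ≡⟨ cong (_+ d) (sum-remove f) ⟩
  (f a + sum (removeAt f a)) + d  ≡⟨ solve 3 (λ x s d → (x :+ s) :+ d := (x :+ d) :+ s) refl (f a) _ d ⟩
  (f a + d) + sum (removeAt f a)  ≤⟨ +-mono-≤ fa+d≤ga (sum-removeAt-mono-≤ a f≤g) ⟩
  g a + sum (removeAt g a)        ≡⟨ sym (sum-remove g) ⟩
  sum g                           ∎
  where open ≤-Reasoning

sum-loss-at : ∀ {k} {f g : Fin k → ℚ} (a : Fin k) {d : ℚ} →
              (∀ u → u ≢ a → f u ≤ g u) → f a ≤ g a + d → sum f ≤ sum g + d
sum-loss-at {suc k} {f} {g} a {d} f≤g fa≤ga+d = begin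
  sum f                           ≡⟨ sum-remove f ⟩
  f a + sum (removeAt f a)        ≤⟨ +-mono-≤ fa≤ga+d (sum-removeAt-mono-≤ a f≤g) ⟩
  (g a + d) + sum (removeAt g a)  ≡⟨ solve 3 (λ x s d → (x :+ d) :+ s := (x :+ s) :+ d) refl (g a) _ d ⟩
  (g a + sum (removeAt g a)) + d  ≡⟨ cong (_+ d) (sym (sum-remove g)) ⟩
  sum g + d                       ∎
  where open ≤-Reasoning

foldr-+-map-allFin : ∀ {k} (f : Fin k → ℚ) → foldr _+_ 0ℚ (map f (allFin k)) ≡ sum f
foldr-+-map-allFin f = trans (cong (foldr _+_ 0ℚ) (map-tabulate id f)) (foldr-tabulate f)
  where
  foldr-tabulate : ∀ {k} (f : Fin k → ℚ) → foldr _+_ 0ℚ (tabulate f) ≡ sum f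
  foldr-tabulate {zero}  f = refl
  foldr-tabulate {suc k} f = cong (_+_ (f zero)) (foldr-tabulate (f ∘ suc))

drift-bound : ∀ {n} (ε : ℚ) (F G : ℕ → ℚ) (d : Fin n → ℚ) → F 0 ≤ G 0 →
              (∀ v → F (suc (toℕ v)) ≤ F (toℕ v) + (d v + ε)) →
              (∀ v → G (toℕ v) + d v ≤ G (suc (toℕ v))) →
              F n ≤ G n + (+ n / 1) * ε
drift-bound {n} ε F G d F₀≤G₀ F-step G-step = go n ℕ.≤-refl
  where
  open ≤-Reasoning
  N : ℕ → ℚ
  N k = (+ k / 1) * ε
  advance : ∀ v → F (toℕ v) ≤ G (toℕ v) + N (toℕ v) →
            F (suc (toℕ v)) ≤ G (suc (toℕ v)) + N (suc (toℕ v))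
  advance v ih = begin
    F (suc t)                         ≤⟨ F-step v ⟩
    F t + (d v + ε)                   ≤⟨ +-monoˡ-≤ (d v + ε) ih ⟩
    (G t + N t) + (d v + ε)           ≡⟨ solve 4 (λ g x d e → (g :+ x :* e) :+ (d :+ e) := (g :+ d) :+ (con 1ℚ :+ x) :* e)
                                                refl (G t) (+ t / 1) (d v) ε ⟩
    (G t + d v) + (1ℚ + + t / 1) * ε  ≤⟨ +-monoˡ-≤ _ (G-step v) ⟩
    G (suc t) + (1ℚ + + t / 1) * ε    ≡⟨ cong (λ x → G (suc t) + x * ε) (sym ([1+k]/1≡1+k/1 t)) ⟩
    G (suc t) + N (suc t)             ∎
    where t = toℕ v
  go : ∀ k → k ℕ.≤ n → F k ≤ G k + N k
  go zero _ = begin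
    F 0              ≤⟨ F₀≤G₀ ⟩
    G 0              ≡⟨ solve 2 (λ g e → g := g :+ con 0ℚ :* e) refl (G 0) ε ⟩
    G 0 + 0ℚ * ε     ∎
  go (suc k) k<n with go k (ℕ.<⇒≤ k<n) | fromℕ< k<n | toℕ-fromℕ< k<n
  ... | ih | v | refl = advance v ih

prefix : ∀ n → ℕ → List (Fin n)
prefix n k = filter (λ v → toℕ v ℕ.<? k) (allFin n)

module _ {n : ℕ} where

  ∈-prefix⁺ : ∀ {k} (v : Fin n) → toℕ v ℕ.< k → v ∈ prefix n k
  ∈-prefix⁺ {k} v v<k = ∈-filter⁺ (λ v → toℕ v ℕ.<? k) (∈-allFin v) v<k

  ∈-prefix⁻ : ∀ {k} {v : Fin n} → v ∈ prefix n k → toℕ v ℕ.< k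
  ∈-prefix⁻ {k} v∈ = proj₂ (∈-filter⁻ (λ v → toℕ v ℕ.<? k) {xs = allFin n} v∈)

  ∈-prefix-suc⁻ : ∀ {v v′ : Fin n} → v′ ∈ prefix n (suc (toℕ v)) →
                  v′ ∈ prefix n (toℕ v) ⊎ v′ ≡ v
  ∈-prefix-suc⁻ {v} {v′} v′∈ with ℕ.m<1+n⇒m<n∨m≡n (∈-prefix⁻ v′∈)
  ... | inj₁ v′<v = inj₁ (∈-prefix⁺ v′ v′<v)
  ... | inj₂ v′≡v = inj₂ (toℕ-injective v′≡v)

curValFrom : ∀ {m n} → Weights m n → Assignment m n → Fin m → ℚ → List (Fin n) → ℚ
curValFrom W σ u b vs = foldr (λ v acc → if does (σ v ≟ᶠ u) then W u v ⊔ acc else acc) b vs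

module _ {m n} (W : Weights m n) (σ : Assignment m n) (u : Fin m) where

  curValFrom-base : ∀ b vs → b ≤ curValFrom W σ u b vs
  curValFrom-base b []       = ≤-refl
  curValFrom-base b (v ∷ vs) with does (σ v ≟ᶠ u)
  ... | true  = p≤q⇒p≤r⊔q (W u v) (curValFrom-base b vs)
  ... | false = curValFrom-base b vs

  curValFrom-∈ : ∀ b {vs v} → v ∈ vs → σ v ≡ u → W u v ≤ curValFrom W σ u b vs
  curValFrom-∈ b {x ∷ vs} (here refl) σv≡u with σ x ≟ᶠ u
  ... | yes _    = p≤p⊔q (W u x) _
  ... | no σx≢u  = ⊥-elim (σx≢u σv≡u)
  curValFrom-∈ b {x ∷ vs} (there v∈vs) σv≡u with does (σ x ≟ᶠ u)
  ... | true  = p≤q⇒p≤r⊔q (W u x) (curValFrom-∈ b v∈vs σv≡u)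
  ... | false = curValFrom-∈ b v∈vs σv≡u

  curValFrom-lub : ∀ {b vs X} → b ≤ X → (∀ {v} → v ∈ vs → σ v ≡ u → W u v ≤ X) →
                   curValFrom W σ u b vs ≤ X
  curValFrom-lub {vs = []}     b≤X W≤X = b≤X
  curValFrom-lub {vs = x ∷ vs} b≤X W≤X with σ x ≟ᶠ u
  ... | yes σx≡u = ⊔-lub (W≤X (here refl) σx≡u) (curValFrom-lub b≤X (W≤X ∘ there))
  ... | no _     = curValFrom-lub b≤X (W≤X ∘ there)

  curValFrom-fiber-mono : ∀ b vs vs′ → (∀ {v} → v ∈ vs → σ v ≡ u → v ∈ vs′) →
                          curValFrom W σ u b vs ≤ curValFrom W σ u b vs′
  curValFrom-fiber-mono b vs vs′ ⊆ =
    curValFrom-lub {vs = vs} (curValFrom-base b vs′)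
      (λ v∈vs σv≡u → curValFrom-∈ b (⊆ v∈vs σv≡u) σv≡u)

  curValFrom-prefix-mono : ∀ b {k k′} → k ℕ.≤ k′ →
                           curValFrom W σ u b (prefix n k) ≤ curValFrom W σ u b (prefix n k′)
  curValFrom-prefix-mono b k≤k′ =
    curValFrom-fiber-mono b _ _ (λ v∈ _ → ∈-prefix⁺ _ (ℕ.<-≤-trans (∈-prefix⁻ v∈) k≤k′))

  curValFrom-prefix-zero : ∀ b → curValFrom W σ u b (prefix n 0) ≤ b
  curValFrom-prefix-zero b = curValFrom-lub ≤-refl (λ v∈ _ → ⊥-elim (ℕ.n≮0 (∈-prefix⁻ v∈)))

  curValFrom-prefix-suc-≢ : ∀ b (v : Fin n) → u ≢ σ v →
    curValFrom W σ u b (prefix n (suc (toℕ v))) ≤ curValFrom W σ u b (prefix n (toℕ v))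
  curValFrom-prefix-suc-≢ b v u≢σv = curValFrom-fiber-mono b _ _ earlier
    where
    earlier : ∀ {v′} → v′ ∈ prefix n (suc (toℕ v)) → σ v′ ≡ u → v′ ∈ prefix n (toℕ v)
    earlier v′∈ σv′≡u with ∈-prefix-suc⁻ v′∈
    ... | inj₁ v′∈prefix = v′∈prefix
    ... | inj₂ refl      = ⊥-elim (u≢σv (sym σv′≡u))

  curValFrom-prefix-suc : ∀ b (v : Fin n) → σ v ≡ u →
    curValFrom W σ u b (prefix n (suc (toℕ v))) ≤ W u v ⊔ curValFrom W σ u b (prefix n (toℕ v))
  curValFrom-prefix-suc b v σv≡u =
    curValFrom-lub {vs = prefix n (suc (toℕ v))}
      (≤-trans (curValFrom-base b (prefix n (toℕ v))) (p≤q⊔p (W u v) _)) bound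
    where
    bound : ∀ {v′} → v′ ∈ prefix n (suc (toℕ v)) → σ v′ ≡ u →
            W u v′ ≤ W u v ⊔ curValFrom W σ u b (prefix n (toℕ v))
    bound v′∈ σv′≡u with ∈-prefix-suc⁻ v′∈
    ... | inj₁ v′∈prefix = p≤q⇒p≤r⊔q (W u v) (curValFrom-∈ b v′∈prefix σv′≡u)
    ... | inj₂ refl      = p≤p⊔q (W u v) _

curValFrom-mono-≤ : ∀ {m n} (W W′ : Weights m n) (σ : Assignment m n) u {b b′} vs →
                    (∀ v → W u v ≤ W′ u v) → b ≤ b′ →
                    curValFrom W σ u b vs ≤ curValFrom W′ σ u b′ vs
curValFrom-mono-≤ W W′ σ u vs W≤W′ b≤b′ =
  curValFrom-lub W σ u {vs = vs} (≤-trans b≤b′ (curValFrom-base W′ σ u _ vs))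
    (λ {v} v∈vs σv≡u → ≤-trans (W≤W′ v) (curValFrom-∈ W′ σ u _ v∈vs σv≡u))

curValFrom-shift : ∀ {m n} (W : Weights m n) (σ : Assignment m n) u {ε} b vs → 0ℚ ≤ ε →
                   curValFrom (λ u v → W u v + ε) σ u b vs ≤ curValFrom W σ u b vs + ε
curValFrom-shift W σ u {ε} b vs 0≤ε =
  curValFrom-lub (λ u v → W u v + ε) σ u {vs = vs}
    (≤-trans (curValFrom-base W σ u b vs) (p≤p+q 0≤ε))
    (λ v∈vs σv≡u → +-monoˡ-≤ ε (curValFrom-∈ W σ u b v∈vs σv≡u))

value≡sum-curVal : ∀ {m n} (W : Weights m n) (σ : Assignment m n) →
                   value W σ ≡ sum (λ u → curVal W σ u (allFin n))
value≡sum-curVal {n = n} W σ = foldr-+-map-allFin (λ u → curVal W σ u (allFin n))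

module GreedyAnalysis {m n : ℕ} {ε : ℚ} (0≤ε : 0ℚ ≤ ε) (w w̃ : Weights m n)
  (w≤w̃+ε : ∀ u v → w u v ≤ w̃ u v + ε) (w̃≤w+ε : ∀ u v → w̃ u v ≤ w u v + ε)
  {σ : Assignment m n} (greedy : IsGreedy w̃ σ) (τ : Assignment m n) where

  open ≤-Reasoning

  nε : ℚ
  nε = (+ n / 1) * ε

  w⁺ : Weights m n
  w⁺ u v = w u v + ε

  total : (Fin m → ℕ → ℚ) → ℕ → ℚ
  total f k = sum (λ u → f u k)

  est : Fin m → ℕ → ℚ
  est u k = curVal w̃ σ u (prefix n k)

  val : Fin m → ℕ → ℚ
  val u k = curVal w σ u (prefix n k)

  val⁺ : Fin m → ℕ → ℚ
  val⁺ u k = curVal w⁺ σ u (prefix n k)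

  optEnvelope : Fin m → ℕ → ℚ
  optEnvelope u k = curValFrom w τ u (est u n) (prefix n k)

  Σest : ℚ
  Σest = total est n

  gain : Fin n → ℚ
  gain v = increment w̃ σ v (σ v)

  Δval : Fin n → ℚ
  Δval v = val (σ v) (suc (toℕ v)) - val (σ v) (toℕ v)

  w≤est+gain+ε : ∀ u v → w u v ≤ (est u n + gain v) + ε
  w≤est+gain+ε u v = begin
    w u v                                ≤⟨ w≤w̃+ε u v ⟩
    w̃ u v + ε                            ≤⟨ +-monoˡ-≤ ε (p≤q+[p-q]⊔0 (w̃ u v) (est u t)) ⟩
    (est u t + increment w̃ σ v u) + ε    ≤⟨ +-monoˡ-≤ ε (+-mono-≤ est≤final (greedy v u)) ⟩
    (est u n + gain v) + ε               ∎
    where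
    t = toℕ v
    est≤final : est u t ≤ est u n
    est≤final = curValFrom-prefix-mono w̃ σ u 0ℚ (ℕ.<⇒≤ (toℕ<n v))

  est-gain : ∀ v → total est (toℕ v) + gain v ≤ total est (suc (toℕ v))
  est-gain v = sum-gain-at a (λ u _ → grow u)
    (q+[p-q]⊔0-lub (curValFrom-∈ w̃ σ a 0ℚ (∈-prefix⁺ v (ℕ.n<1+n (toℕ v))) refl) (grow a))
    where
    a = σ v
    grow : ∀ u → est u (toℕ v) ≤ est u (suc (toℕ v))
    grow u = curValFrom-prefix-mono w̃ σ u 0ℚ (ℕ.n≤1+n (toℕ v))

  optEnvelope-step : ∀ v → total optEnvelope (suc (toℕ v)) ≤ total optEnvelope (toℕ v) + (gain v + ε)
  optEnvelope-step v = sum-loss-at a (λ u u≢a → curValFrom-prefix-suc-≢ w τ u (est u n) v u≢a)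
    (≤-trans (curValFrom-prefix-suc w τ a (est a n) v refl) (⊔-lub new (p≤p+q 0≤gain+ε)))
    where
    a = τ v
    t = toℕ v
    0≤gain+ε : 0ℚ ≤ gain v + ε
    0≤gain+ε = +-mono-≤ (p≤q⊔p (w̃ (σ v) v - est (σ v) t) 0ℚ) 0≤ε
    final≤optEnvelope : est a n ≤ optEnvelope a t
    final≤optEnvelope = curValFrom-base w τ a (est a n) (prefix n t)
    new : w a v ≤ optEnvelope a t + (gain v + ε)
    new = begin
      w a v                            ≤⟨ w≤est+gain+ε a v ⟩
      (est a n + gain v) + ε           ≤⟨ +-monoˡ-≤ ε (+-monoˡ-≤ (gain v) final≤optEnvelope) ⟩
      (optEnvelope a t + gain v) + ε   ≡⟨ +-assoc (optEnvelope a t) (gain v) ε ⟩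
      optEnvelope a t + (gain v + ε)   ∎

  val-step : ∀ v → total val (toℕ v) + Δval v ≤ total val (suc (toℕ v))
  val-step v = sum-gain-at a (λ u _ → curValFrom-prefix-mono w σ u 0ℚ (ℕ.n≤1+n t))
    (≤-reflexive (solve 2 (λ x y → x :+ (y :- x) := y) refl (val a t) (val a (suc t))))
    where
    a = σ v
    t = toℕ v

  val⁺-step : ∀ v → total val⁺ (suc (toℕ v)) ≤ total val⁺ (toℕ v) + (Δval v + ε)
  val⁺-step v = sum-loss-at a (λ u u≢a → curValFrom-prefix-suc-≢ w⁺ σ u 0ℚ v u≢a) (begin
      val⁺ a (suc t)            ≤⟨ curValFrom-shift w σ a 0ℚ (prefix n (suc t)) 0≤ε ⟩
      val a (suc t) + ε         ≡⟨ solve 3 (λ x y e → y :+ e := x :+ ((y :- x) :+ e))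
                                           refl (val a t) (val a (suc t)) ε ⟩
      val a t + (Δval v + ε)    ≤⟨ +-monoˡ-≤ (Δval v + ε) val≤val⁺ ⟩
      val⁺ a t + (Δval v + ε)   ∎)
    where
    a = σ v
    t = toℕ v
    val≤val⁺ : val a t ≤ val⁺ a t
    val≤val⁺ = curValFrom-mono-≤ w w⁺ σ a (prefix n t) (λ _ → p≤p+q 0≤ε) ≤-refl

  Σest≤alg+nε : Σest ≤ value w σ + nε
  Σest≤alg+nε = begin
    Σest                                      ≤⟨ sum-mono-≤ est≤val⁺ ⟩
    total val⁺ n                              ≤⟨ drift-bound ε (total val⁺) (total val) Δval
                                                   (sum-mono-≤ val⁺₀≤val₀) val⁺-step val-step ⟩
    total val n + nε                          ≤⟨ +-monoˡ-≤ nε (sum-mono-≤ val≤alg) ⟩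
    sum (λ u → curVal w σ u (allFin n)) + nε  ≡⟨ cong (_+ nε) (sym (value≡sum-curVal w σ)) ⟩
    value w σ + nε                            ∎
    where
    est≤val⁺ : ∀ u → est u n ≤ val⁺ u n
    est≤val⁺ u = curValFrom-mono-≤ w̃ w⁺ σ u (prefix n n) (w̃≤w+ε u) ≤-refl
    val⁺₀≤val₀ : ∀ u → val⁺ u 0 ≤ val u 0
    val⁺₀≤val₀ u = ≤-trans (curValFrom-prefix-zero w⁺ σ u 0ℚ) (curValFrom-base w σ u 0ℚ (prefix n 0))
    val≤alg : ∀ u → val u n ≤ curVal w σ u (allFin n)
    val≤alg u = curValFrom-fiber-mono w σ u 0ℚ (prefix n n) (allFin n) (λ {v} _ _ → ∈-allFin v)

  opt≤2Σest+nε : value w τ ≤ (Σest + Σest) + nε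
  opt≤2Σest+nε = begin
    value w τ                             ≡⟨ value≡sum-curVal w τ ⟩
    sum (λ u → curVal w τ u (allFin n))   ≤⟨ sum-mono-≤ opt≤optEnvelope ⟩
    total optEnvelope n                   ≤⟨ drift-bound ε (total optEnvelope) (λ k → Σest + total est k) gain
                                               base optEnvelope-step Σest+est-gain ⟩
    (Σest + Σest) + nε                    ∎
    where
    opt≤optEnvelope : ∀ u → curVal w τ u (allFin n) ≤ optEnvelope u n
    opt≤optEnvelope u = begin
      curVal w τ u (allFin n)               ≤⟨ curValFrom-fiber-mono w τ u 0ℚ (allFin n) (prefix n n)
                                                 (λ {v} _ _ → ∈-prefix⁺ v (toℕ<n v)) ⟩
      curVal w τ u (prefix n n)             ≤⟨ curValFrom-mono-≤ w w τ u (prefix n n) (λ _ → ≤-refl)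
                                                 (curValFrom-base w̃ σ u 0ℚ (prefix n n)) ⟩
      optEnvelope u n                       ∎
    base : total optEnvelope 0 ≤ Σest + total est 0
    base = ≤-trans (sum-mono-≤ (λ u → curValFrom-prefix-zero w τ u (est u n)))
                   (p≤p+q (sum-nonNeg (λ u → curValFrom-base w̃ σ u 0ℚ (prefix n 0))))
    Σest+est-gain : ∀ v → (Σest + total est (toℕ v)) + gain v ≤ Σest + total est (suc (toℕ v))
    Σest+est-gain v = ≤-trans (≤-reflexive (+-assoc Σest _ (gain v))) (+-monoʳ-≤ Σest (est-gain v))

lemma3p6 : (m n : ℕ) (ε : ℚ) → 0ℚ < ε →
    (w w̃ : Weights (suc m) n) →
    (∀ u v → 0ℚ ≤ w u v) →
    (∀ u v → w u v - ε ≤ w̃ u v) →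
    (∀ u v → w̃ u v ≤ w u v + ε) →
    (σ : Assignment (suc m) n) → IsGreedy w̃ σ →
    (τ : Assignment (suc m) n) →
    ½ * value w τ - (+ 3 / 2) * (+ n / 1) * ε ≤ value w σ
lemma3p6 m n ε 0<ε w w̃ _ w-ε≤w̃ w̃≤w+ε σ greedy τ = begin
  ½ * value w τ - (+ 3 / 2) * (+ n / 1) * ε
    ≤⟨ +-monoˡ-≤ _ (*-monoˡ-≤-nonNeg ½ opt≤2alg+3nε) ⟩
  ½ * (((alg + nε) + (alg + nε)) + nε) - (+ 3 / 2) * (+ n / 1) * ε
    ≡⟨ solve 3 (λ a k e → con ½ :* (((a :+ k :* e) :+ (a :+ k :* e)) :+ k :* e) :- con (+ 3 / 2) :* k :* e := a)
               refl alg (+ n / 1) ε ⟩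
  alg
    ∎
  where
  open ≤-Reasoning
  open GreedyAnalysis (<⇒≤ 0<ε) w w̃ (λ u v → p-r≤q⇒p≤q+r (w-ε≤w̃ u v)) w̃≤w+ε greedy τ
  alg : ℚ
  alg = value w σ
  opt≤2alg+3nε : value w τ ≤ ((alg + nε) + (alg + nε)) + nε
  opt≤2alg+3nε = ≤-trans opt≤2Σest+nε (+-monoˡ-≤ nε (+-mono-≤ Σest≤alg+nε Σest≤alg+nε))
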